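{- Let $\tau$ be a type. If $u:w\hookrightarrow w_1$ is an inclusion and $v\Vdash^\tau_w a$ then $v\Vdash^\tau_{w_1}u.a$.
   Context: Language: CBV with types $\tau::=\mathtt{int}\mid\mathtt{bool}\mid\mathtt{name}\mid\tau\to\tau'$, recursive functions, equality on names/ints, and $\mathtt{new}$. Concrete semantics $[\![\cdot]\!]^c$: $[\![\mathtt{int}]\!]^c=\mathbb{Z}$, $[\![\mathtt{bool}]\!]^c=\mathbb{B}$, $[\![\mathtt{name}]\!]^c=\mathbb{N}$, $[\![\tau\to\tau']\!]^c=[\![\tau]\!]^c\to(\mathbb{N}\to\mathbb{N}\times[\![\tau']\!]^c)_\bot$. Abstract semantics $[\![\tau]\!]$ as setoid-valued functors on worlds (finite sets of naturals with injections), base types discrete, names $Nw=w$, $[\![\tau\to\tau']\!]=[\![\tau]\!]\Rightarrow T[\![\tau']\!]$ with $T$ the dynamic allocation monad ($TAw$ = $\bot$ or pairs $(w_1,a)$, $w\subseteq w_1$, $a\in Aw_1$). Realizability relations $\Vdash^\tau_w\subseteq[\![\tau]\!]^c\times[\![\tau]\!]w$ and $\Vdash^{T\tau}_w$: at base types and $\mathtt{name}$ it is equality; $f\Vdash^{\tau\to\tau'}_w g$ iff for all $w_1\supseteq w$ and $v\Vdash^\tau_{w_1}a$, $f(v)\Vdash^{T\tau'}_{w_1}g_0(w\hookrightarrow w_1,a)$; $c\Vdash^{T\tau}_w e$ iff ($c(\max(w)+1)=\bot\Leftrightarrow e=\bot$) and (if $c(\max(w)+1)=(n_1,v)$ and $e=(w_1,a)$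 then $n_1=\max(w_1)+1$ and $v\Vdash^\tau_{w_1}a$). -}

module Defs where

open import Data.Nat using (ℕ; zero; suc; _+_; _⊔_; _<_; _≤_)
open import Data.Nat.Properties using (_≟_; +-cancelʳ-≡; m≤n+m; <-≤-trans; <-irrefl; m≤m⊔n; m≤n⊔m; ≤-trans; n≤1+n)
open import Data.Integer using (ℤ)
open import Data.Bool using (Bool)
open import Data.Maybe using (Maybe; just; nothing)
open import Data.Product using (Σ; _×_; _,_)
open import Data.Unit using (⊤)
open import Data.Empty using (⊥; ⊥-elim)
open import Data.List using (List; []; _∷_; _++_; map; foldr)
open import Data.List.Relation.Unary.Any using (here; there)
open import Data.List.Membership.Propositional using (_∈_)
open import Data.List.Membership.Propositional.Properties using (∈-map⁺; ∈-++⁺ˡ; ∈-++⁺ʳ)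
open import Data.List.Membership.DecPropositional _≟_ using (_∈?_)
open import Data.List.Relation.Binary.Subset.Propositional using (_⊆_)
open import Relation.Nullary using (yes; no; ¬_)
open import Relation.Nullary.Decidable using (recompute)
open import Relation.Binary.PropositionalEquality using (_≡_; refl; sym; trans; cong; subst)

infixr 5 _⇒_
data Ty : Set where
  int bool name : Ty
  _⇒_ : Ty → Ty → Ty

-- Concrete semantics  [[τ]]^c ; the lifting (-)_⊥ is Maybe

⟦_⟧c : Ty → Set
⟦ int ⟧c = ℤ
⟦ bool ⟧c = Bool
⟦ name ⟧c = ℕ
⟦ τ ⇒ τ' ⟧c = ⟦ τ ⟧c → ℕ → Maybe (ℕ × ⟦ τ' ⟧c)

-- Worlds: finite sets of naturals (represented by lists, as sets via _∈_)

World : Set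
World = List ℕ

next : World → ℕ
next = foldr (λ n m → suc n ⊔ m) 0

record Inj (w w' : World) : Set where
  constructor mkInj
  field
    fun  : ℕ → ℕ
    .maps : ∀ {n} → n ∈ w → fun n ∈ w'
    .inj  : ∀ {m n} → m ∈ w → n ∈ w → fun m ≡ fun n → m ≡ n
open Inj public

idInj : ∀ {w} → Inj w w
idInj = record { fun = λ n → n ; maps = λ p → p ; inj = λ _ _ e → e }

infixr 9 _∘ᵢ_
_∘ᵢ_ : ∀ {w1 w2 w3} → Inj w2 w3 → Inj w1 w2 → Inj w1 w3
mkInj g mv iv ∘ᵢ mkInj f mu iu = mkInj (λ n → g (f n)) (λ p → mv (mu p))
  (λ p q e → iu p q (iv (mu p) (mu q) e))

incl : ∀ {w w1} → w ⊆ w1 → Inj w w1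
incl p = record { fun = λ n → n ; maps = p ; inj = λ _ _ e → e }

_≈ᵢ_ : ∀ {w w'} → Inj w w' → Inj w w' → Set
_≈ᵢ_ {w} u u' = ∀ {n} → n ∈ w → fun u n ≡ fun u' n

-- Setoid-valued functors on worlds (carrier, equality, action)

record Fam : Set₁ where
  field
    C   : World → Set
    Eq  : ∀ {w} → C w → C w → Set
    act : ∀ {w w'} → Inj w w' → C w → C w'
open Fam public

Disc : Set → Fam
Disc X = record { C = λ _ → X ; Eq = _≡_ ; act = λ _ x → x }

record Name (w : World) : Set where
  constructor nm
  field
    val  : ℕ
    .mem : val ∈ w
open Name public

NameF : Fam
NameF = record
  { C = Name
  ; Eq = λ a b → val a ≡ val b
  ; act = actN }
  where
  actN : ∀ {w w'} → Inj w w' → Name w → Name w'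
  actN (mkInj f m _) (nm x p) = nm (f x) (m p)

TC : Fam → World → Set
TC A w = Maybe (Σ World λ w1 → (w ⊆ w1) × C A w1)

TEq : (A : Fam) → ∀ {w} → TC A w → TC A w → Set
TEq A nothing nothing = ⊤
TEq A {w} (just (w1 , _ , a)) (just (w2 , _ , b)) =
  Σ World λ w3 → Σ (Inj w1 w3) λ u1 → Σ (Inj w2 w3) λ u2 →
    (∀ {n} → n ∈ w → fun u1 n ≡ n) × (∀ {n} → n ∈ w → fun u2 n ≡ n) ×
    Eq A (act A u1 a) (act A u2 b)
TEq A nothing (just _) = ⊥
TEq A (just _) nothing = ⊥

-- action of T: the names of w1 are renamed: those of w along u,
-- the others shifted above w'
∈⇒<next : ∀ {n w} → n ∈ w → n < next w
∈⇒<next {n} {x ∷ w} (here refl) = m≤m⊔n (suc n) (next w)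
∈⇒<next {n} {x ∷ w} (there p) = ≤-trans (∈⇒<next p) (m≤n⊔m (suc x) (next w))

extInj : ∀ {w w' w1} → Inj w w' → Inj w1 (w' ++ map (_+ next w') w1)
extInj {w} {w'} {w1} (mkInj g mu iu) = mkInj f (mp mu) (ij mu iu)
  where
  f : ℕ → ℕ
  f n with n ∈? w
  ... | yes _ = g n
  ... | no _ = n + next w'
  mp : (∀ {n} → n ∈ w → g n ∈ w') → ∀ {n} → n ∈ w1 → f n ∈ (w' ++ map (_+ next w') w1)
  mp mu {n} p with n ∈? w
  ... | yes q = ∈-++⁺ˡ (mu q)
  ... | no _ = ∈-++⁺ʳ w' (∈-map⁺ (_+ next w') p)
  ij : (∀ {n} → n ∈ w → g n ∈ w') → (∀ {m n} → m ∈ w → n ∈ w → g m ≡ g n → m ≡ n) →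
       ∀ {m n} → m ∈ w1 → n ∈ w1 → f m ≡ f n → m ≡ n
  ij mu iu {m} {n} _ _ e with m ∈? w | n ∈? w
  ... | yes p | yes q = iu p q e
  ... | no _ | no _ = +-cancelʳ-≡ _ m n e
  ... | yes p | no _ = ⊥-elim (<-irrefl e (<-≤-trans (∈⇒<next (mu p)) (m≤n+m (next w') n)))
  ... | no _ | yes q = ⊥-elim (<-irrefl (sym e) (<-≤-trans (∈⇒<next (mu q)) (m≤n+m (next w') m)))

Tact : (A : Fam) → ∀ {w w'} → Inj w w' → TC A w → TC A w'
Tact A u nothing = nothing
Tact A {w' = w'} u (just (w1 , _ , a)) =
  just (w' ++ map (_+ next w') w1 , ∈-++⁺ˡ , act A (extInj u) a)

TF : Fam → Fam
TF A = record { C = TC A ; Eq = TEq A ; act = Tact A }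

-- Exponential A ⇒ B in the functor category: natural families
--   g_{w1} : Inj w w1 × A w1 → B w1
-- respecting the setoid equalities

record ExpC (A B : Fam) (w : World) : Set where
  field
    ap   : ∀ {w1} → Inj w w1 → C A w1 → C B w1
    resp : ∀ {w1} {u u' : Inj w w1} {a a' : C A w1} →
           u ≈ᵢ u' → Eq A a a' → Eq B (ap u a) (ap u' a')
    nat  : ∀ {w1 w2} (u : Inj w w1) (v : Inj w1 w2) (a : C A w1) →
           Eq B (ap (v ∘ᵢ u) (act A v a)) (act B v (ap u a))
open ExpC public

Exp : Fam → Fam → Fam
Exp A B = record
  { C = ExpC A B
  ; Eq = λ {w} g g' → ∀ {w1} (u : Inj w w1) (a : C A w1) → Eq B (ap g u a) (ap g' u a)
  ; act = actE }
  where
  actE : ∀ {w w'} → Inj w w' → ExpC A B w → ExpC A B w'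
  actE {w} {w'} u@(mkInj f mu iu) g = record
      { ap = λ u' a → ap g (u' ∘ᵢ u) a
      ; resp = λ {w1} {u'} {u''} e ea →
          resp g (λ {n} p → e (recompute (f n ∈? w') (mu p))) ea
      ; nat = λ u' v a → nat g (u' ∘ᵢ u) v a }

⟦_⟧ : Ty → Fam
⟦ int ⟧ = Disc ℤ
⟦ bool ⟧ = Disc Bool
⟦ name ⟧ = NameF
⟦ τ ⇒ τ' ⟧ = Exp ⟦ τ ⟧ (TF ⟦ τ' ⟧)

mutual
  Real : (τ : Ty) (w : World) → ⟦ τ ⟧c → C ⟦ τ ⟧ w → Set
  Real int w v a = v ≡ a
  Real bool w v a = v ≡ a
  Real name w v a = v ≡ val a
  Real (τ ⇒ τ') w f g =
    ∀ (w1 : World) (p : w ⊆ w1) (v : ⟦ τ ⟧c) (a : C ⟦ τ ⟧ w1) →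
      Real τ w1 v a → RealT τ' w1 (f v) (ap g (incl p) a)

  RealT : (τ : Ty) (w : World) → (ℕ → Maybe (ℕ × ⟦ τ ⟧c)) → C (TF ⟦ τ ⟧) w → Set
  RealT τ w c e = RealT' τ (c (next w)) e

  RealT' : (τ : Ty) {w : World} → Maybe (ℕ × ⟦ τ ⟧c) → C (TF ⟦ τ ⟧) w → Set
  RealT' τ nothing nothing = ⊤
  RealT' τ (just (n1 , v)) (just (w1 , _ , a)) = (n1 ≡ next w1) × Real τ w1 v a
  RealT' τ nothing (just _) = ⊥
  RealT' τ (just _) nothing = ⊥

module Submission where

open import Defs
open import Data.List.Relation.Binary.Subset.Propositional using (_⊆_)
open import Data.List.Relation.Binary.Subset.Propositional.Properties using (⊆-trans)

-- Inclusions act trivially on every carrier value that realizability inspects: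
-- on names they keep the underlying number, and on functions they precompose,
-- where  incl q ∘ᵢ incl p  is  incl (⊆-trans p q)  up to irrelevant membership proofs.
lemma7p2 : (τ : Ty) {w w1 : World} (p : w ⊆ w1) (v : ⟦ τ ⟧c) (a : C ⟦ τ ⟧ w) →
    Real τ w v a → Real τ w1 v (act ⟦ τ ⟧ (incl p) a)
lemma7p2 int p v a v⊩a = v⊩a
lemma7p2 bool p v a v⊩a = v⊩a
lemma7p2 name p v a v⊩a = v⊩a
lemma7p2 (τ ⇒ τ') p f g f⊩g = λ w2 q → f⊩g w2 (⊆-trans p q)
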